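{- Let $\Sigma$ be a finite alphabet with $q>1$ letters. For $n,m\in\mathbb{N}$ let $B(n,m)$ be the number of closed words of length $n$ over $\Sigma$ whose maximal border has length $m$, and for integers $\ell\ge 0$ let $\mu(\ell,m)=\max\{\Sigma_w(\ell)\mid w\in\Sigma^m\}$, where $\Sigma_w(\ell)$ is the number of words of length $\ell$ over $\Sigma$ not containing $w$ as a factor. Then for $n,m\in\mathbb{N}$: (i) if $2m>n$ then $B(n,m)\leq q^{\lceil n/2\rceil}$; (ii) if $2m\leq n$ then $B(n,m)\leq q^m\mu(n-2m,m)$.
   Context: A non-empty word $w$ is a border of $u$ if $|w|<|u|$ and $w$ is both a prefix and a suffix of $u$; a border $w$ of $u$ is the maximal border if every border of $u$ has length at most $|w|$. A word $u$ with a border $w$ is closed if $u$ contains exactly two occurrences of $w$. $\mathbb{N}$ is the set of positive integers; a factor is a contiguous subword. -}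

module Defs where

open import Data.Nat using (ℕ; zero; suc; _+_; _*_; _^_; _⊔_; _<ᵇ_; _≡ᵇ_; _/_)
open import Data.Bool using (Bool; true; false; _∧_; _∨_; not; if_then_else_)
open import Data.Fin using (Fin)
open import Data.Fin.Properties using (_≟_)
open import Data.List using (List; []; _∷_; length; filter; map; concatMap; allFin; filterᵇ; take; drop; foldr; upTo; reverse)
open import Data.Bool.ListAction using (any; all)
open import Relation.Nullary.Decidable using (⌊_⌋)
open import Relation.Unary using (Pred)
open import Relation.Nullary using (yes; no)

Word : ℕ → Set
Word q = List (Fin q)

words : (q n : ℕ) → List (Word q)
words q zero    = [] ∷ []
words q (suc n) = concatMap (λ a → map (a ∷_) (words q n)) (allFin q)

eqW : {q : ℕ} → Word q → Word q → Bool
eqW []       []       = true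
eqW (a ∷ u)  (b ∷ v)  = ⌊ a ≟ b ⌋ ∧ eqW u v
eqW _        _        = false

isPrefix : {q : ℕ} → Word q → Word q → Bool
isPrefix []      _       = true
isPrefix (a ∷ w) []      = false
isPrefix (a ∷ w) (b ∷ u) = ⌊ a ≟ b ⌋ ∧ isPrefix w u

isSuffix : {q : ℕ} → Word q → Word q → Bool
isSuffix w u = isPrefix (reverse w) (reverse u)

nonEmpty : {q : ℕ} → Word q → Bool
nonEmpty []      = false
nonEmpty (_ ∷ _) = true

isBorder : {q : ℕ} → Word q → Word q → Bool
isBorder w u = nonEmpty w ∧ (length w <ᵇ length u) ∧ isPrefix w u ∧ isSuffix w u

occ : {q : ℕ} → Word q → Word q → ℕ
occ w []      = if eqW w [] then 1 else 0
occ w (a ∷ u) = (if isPrefix w (a ∷ u) then 1 else 0) + occ w u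

-- u has a border of length k (the border of length k, if any, is the prefix of length k)
hasBorderOfLength : {q : ℕ} → ℕ → Word q → Bool
hasBorderOfLength k u = isBorder (take k u) u ∧ (length (take k u) ≡ᵇ k)

maxBorderLength : {q : ℕ} → ℕ → Word q → Bool
maxBorderLength {q} m u =
  hasBorderOfLength m u ∧
  all (λ w → not (isBorder w u) ∨ (length w <ᵇ suc m))
      (concatMap (words q) (upTo (length u)))

closed : {q : ℕ} → Word q → Bool
closed {q} u =
  any (λ w → isBorder w u ∧ (occ w u ≡ᵇ 2))
      (concatMap (words q) (upTo (length u)))

count : {A : Set} → (A → Bool) → List A → ℕ
count p xs = length (filterᵇ p xs)

B : (q n m : ℕ) → ℕ
B q n m = count (λ u → closed u ∧ maxBorderLength m u) (words q n)

isFactor : {q : ℕ} → Word q → Word q → Bool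
isFactor w u = 0 <ᵇ occ w u

avoid : {q : ℕ} → Word q → ℕ → ℕ
avoid {q} w ℓ = count (λ u → not (isFactor w u)) (words q ℓ)

μ : (q ℓ m : ℕ) → ℕ
μ q ℓ m = foldr _⊔_ 0 (map (λ w → avoid w ℓ) (words q m))

ceilHalf : ℕ → ℕ
ceilHalf n = (n + 1) / 2

module Submission where

-- Write a word counted by B q n m as x y with |y| = m. Its border of length m is then y itself, so
-- y = take m (x ++ y); for non-empty x this determines y letter by letter. Hence there is at most
-- one such word for each of the q^(n ∸ m) words x, and n ∸ m ≤ ⌈n/2⌉ when n < 2m.
-- When 2m ≤ n, write the word as x v z with |x| = |z| = m, so that z = x is its border of length m.
-- The border witnessing closedness has length at most m; were it shorter, it would be a border of x
-- and occur three times (at the start, and at both ends of the final x). So x occurs exactly twice,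
-- v avoids x, and each of the q^m words x admits at most Σ_x(n ∸ 2m) ≤ μ(n ∸ 2m, m) words v.

open import Defs
open import Data.Bool using (Bool; true; false; T; not; _∧_; _∨_)
open import Data.Bool.Properties using (T-∧)
open import Data.Fin using (Fin)
open import Data.Fin.Properties using (_≟_)
open import Data.List using (List; []; _∷_; _++_; concatMap; upTo; length; map; foldr; take; drop; reverse; allFin; filterᵇ; cartesianProductWith)
open import Data.List.Properties
  using (filter-none; filter-++; ∷-injective; ++-assoc; ++-identityʳ; length-++; length-map; length-tabulate; map-++; map-∘; map-id; map-cong; take-take; take++drop≡id; reverse-++; reverse-involutive; length-reverse; cartesianProductWith-distribʳ-++)
open import Data.List.Relation.Unary.All as All using (All; []; _∷_)
open import Data.List.Relation.Unary.All.Properties using (++⁺; map⁺; all⁺)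
import Data.List.Relation.Unary.Any as Any
open import Data.List.Relation.Unary.Any.Properties using (any⁻)
open import Data.List.Relation.Unary.AllPairs using ([]; _∷_)
open import Data.List.Relation.Unary.Unique.Propositional using (Unique)
open import Data.List.Relation.Unary.Unique.Propositional.Properties using (allFin⁺; cartesianProductWith⁺)
open import Data.Nat using (ℕ; zero; suc; _+_; _*_; _^_; _∸_; _⊔_; _≤_; _<_; z≤n; s≤s; s≤s⁻¹; z<s; NonZero; >-nonZero; _<ᵇ_)
open import Data.Nat.DivMod using (m*n/n≡m; /-monoˡ-≤)
open import Data.Nat.ListAction using (sum)
open import Data.Nat.Properties
  using (+-assoc; +-comm; +-identityʳ; +-mono-≤; +-monoʳ-≤; +-monoˡ-≤; +-cancelʳ-≡; +-cancelʳ-<; *-comm; m≤n+m; m≤m+n; m≤m⊔n; m≤n⊔m; m≤n⇒m⊓n≡m; m≤n⇒m<n∨m≡n; m∸n+n≡m; ^-monoʳ-≤; ≤-refl; ≤-reflexive; ≤-trans; <-trans; <⇒≤; <⇒≱; ≮⇒≥; n≮n; suc-injective; _<?_; <ᵇ⇒<; ≡ᵇ⇒≡; module ≤-Reasoning)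
open import Data.Sum using (inj₁; inj₂)
open import Data.Product using (∃-syntax; _×_; _,_; proj₁; proj₂)
open import Function using (_∘_; Equivalence)
open import Relation.Binary.PropositionalEquality
  using (_≡_; _≢_; refl; sym; trans; cong; cong₂; subst; subst₂; module ≡-Reasoning)
open import Relation.Nullary using (¬_; yes; no; contradiction)
open import Relation.Nullary.Decidable using (T?)

private
  variable
    X Y C : Set
    q : ℕ

count-∷ : (p : X → Bool) (x : X) (xs : List X) → count p (x ∷ xs) ≡ count p (x ∷ []) + count p xs
count-∷ p x xs with p x
... | true  = refl
... | false = refl

count-++ : (p : X → Bool) (xs ys : List X) → count p (xs ++ ys) ≡ count p xs + count p ys
count-++ p xs ys = trans (cong length (filter-++ (T? ∘ p) xs ys)) (length-++ (filterᵇ p xs))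

count-map : (p : Y → Bool) (f : X → Y) (xs : List X) → count p (map f xs) ≡ count (p ∘ f) xs
count-map p f []       = refl
count-map p f (x ∷ xs) with p (f x)
... | true  = cong suc (count-map p f xs)
... | false = count-map p f xs

count-true : (xs : List X) → count (λ _ → true) xs ≡ length xs
count-true []       = refl
count-true (x ∷ xs) = cong suc (count-true xs)

count-none : (p : X → Bool) {xs : List X} → All (λ x → ¬ T (p x)) xs → count p xs ≡ 0
count-none p none = cong length (filter-none (T? ∘ p) none)

count-as-sum : (p : X → Bool) (xs : List X) → count p xs ≡ sum (map (λ x → count p (x ∷ [])) xs)
count-as-sum p []       = refl
count-as-sum p (x ∷ xs) = trans (count-∷ p x xs) (cong (count p (x ∷ []) +_) (count-as-sum p xs))

count-unique-≤1 : {R : X → Set} (p : X → Bool) {xs : List X} → Unique xs → All R xs →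
  (∀ {x y} → R x → R y → T (p x) → T (p y) → x ≡ y) → count p xs ≤ 1
count-unique-≤1 p {[]}     []             []         _    = z≤n
count-unique-≤1 {R = R} p {x ∷ xs} (x∉xs ∷ uniq) (Rx ∷ Rxs) once with p x in px
... | true  = s≤s (≤-reflexive (count-none p (All.zipWith others (x∉xs , Rxs))))
  where
  others : ∀ {y} → x ≢ y × R y → ¬ T (p y)
  others (x≢y , Ry) py = x≢y (once Rx Ry (subst T (sym px) _) py)
... | false = count-unique-≤1 p uniq Rxs once

sum-map-mono : {f g : X → ℕ} {xs : List X} → All (λ x → f x ≤ g x) xs → sum (map f xs) ≤ sum (map g xs)
sum-map-mono []         = z≤n
sum-map-mono (fx≤gx ∷ h) = +-mono-≤ fx≤gx (sum-map-mono h)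

sum-map-≤-* : {f : X → ℕ} {K : ℕ} {xs : List X} → All (λ x → f x ≤ K) xs → sum (map f xs) ≤ length xs * K
sum-map-≤-* []          = z≤n
sum-map-≤-* (fx≤K ∷ h) = +-mono-≤ fx≤K (sum-map-≤-* h)

≤-foldr-⊔ : (f : X → ℕ) (xs : List X) → All (λ x → f x ≤ foldr _⊔_ 0 (map f xs)) xs
≤-foldr-⊔ f []       = []
≤-foldr-⊔ f (x ∷ xs) = m≤m⊔n (f x) _ ∷ All.map (λ h → ≤-trans h (m≤n⊔m (f x) _)) (≤-foldr-⊔ f xs)

cartesianProductWith-as-concatMap : (f : X → Y → C) (xs : List X) (ys : List Y) →
  concatMap (λ x → map (f x) ys) xs ≡ cartesianProductWith f xs ys
cartesianProductWith-as-concatMap f []       ys = refl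
cartesianProductWith-as-concatMap f (x ∷ xs) ys = cong (map (f x) ys ++_) (cartesianProductWith-as-concatMap f xs ys)

count-cartesianProductWith : (p : C → Bool) (f : X → Y → C) (xs : List X) (ys : List Y) →
  count p (cartesianProductWith f xs ys) ≡ sum (map (λ x → count (p ∘ f x) ys) xs)
count-cartesianProductWith p f []       ys = refl
count-cartesianProductWith p f (x ∷ xs) ys = begin
  count p (map (f x) ys ++ cartesianProductWith f xs ys)
    ≡⟨ count-++ p (map (f x) ys) _ ⟩
  count p (map (f x) ys) + count p (cartesianProductWith f xs ys)
    ≡⟨ cong₂ _+_ (count-map p (f x) ys) (count-cartesianProductWith p f xs ys) ⟩
  count (p ∘ f x) ys + sum (map (λ x → count (p ∘ f x) ys) xs)
    ∎
  where open ≡-Reasoning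

length-cartesianProductWith : (f : X → Y → C) (xs : List X) (ys : List Y) →
  length (cartesianProductWith f xs ys) ≡ length xs * length ys
length-cartesianProductWith f []       ys = refl
length-cartesianProductWith f (x ∷ xs) ys = begin
  length (map (f x) ys ++ cartesianProductWith f xs ys)        ≡⟨ length-++ (map (f x) ys) ⟩
  length (map (f x) ys) + length (cartesianProductWith f xs ys) ≡⟨ cong₂ _+_ (length-map (f x) ys) (length-cartesianProductWith f xs ys) ⟩
  length ys + length xs * length ys                            ∎
  where open ≡-Reasoning

All-cartesianProductWith : {R : Y → Set} {S : C → Set} (f : X → Y → C) (xs : List X) {ys : List Y} →
  (∀ {x y} → R y → S (f x y)) → All R ys → All S (cartesianProductWith f xs ys)
All-cartesianProductWith f []       g rs = []
All-cartesianProductWith f (x ∷ xs) g rs = ++⁺ (map⁺ (All.map g rs)) (All-cartesianProductWith f xs g rs)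

cartesianProductWith-assoc : {Z W U V : Set} (f : X → U → V) (g : Y → Z → U) (h : W → Z → V) (k : X → Y → W) →
  (∀ x y z → f x (g y z) ≡ h (k x y) z) → (xs : List X) (ys : List Y) (zs : List Z) →
  cartesianProductWith f xs (cartesianProductWith g ys zs) ≡ cartesianProductWith h (cartesianProductWith k xs ys) zs
cartesianProductWith-assoc f g h k law []       ys zs = refl
cartesianProductWith-assoc f g h k law (x ∷ xs) ys zs = begin
  map (f x) (cartesianProductWith g ys zs) ++ cartesianProductWith f xs (cartesianProductWith g ys zs)
    ≡⟨ cong₂ _++_ (map-cartesianProductWith ys) (cartesianProductWith-assoc f g h k law xs ys zs) ⟩
  cartesianProductWith h (map (k x) ys) zs ++ cartesianProductWith h (cartesianProductWith k xs ys) zs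
    ≡⟨ cartesianProductWith-distribʳ-++ h (map (k x) ys) _ zs ⟨
  cartesianProductWith h (map (k x) ys ++ cartesianProductWith k xs ys) zs
    ∎
  where
  open ≡-Reasoning
  map-cartesianProductWith : ∀ ys → map (f x) (cartesianProductWith g ys zs) ≡ cartesianProductWith h (map (k x) ys) zs
  map-cartesianProductWith []       = refl
  map-cartesianProductWith (y ∷ ys) = begin
    map (f x) (map (g y) zs ++ cartesianProductWith g ys zs)
      ≡⟨ map-++ (f x) (map (g y) zs) _ ⟩
    map (f x) (map (g y) zs) ++ map (f x) (cartesianProductWith g ys zs)
      ≡⟨ cong₂ _++_ (trans (sym (map-∘ zs)) (map-cong (law x y) zs)) (map-cartesianProductWith ys) ⟩
    map (h (k x y)) zs ++ cartesianProductWith h (map (k x) ys) zs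
      ∎

words-suc : (q n : ℕ) → words q (suc n) ≡ cartesianProductWith _∷_ (allFin q) (words q n)
words-suc q n = cartesianProductWith-as-concatMap _∷_ (allFin q) (words q n)

words-+ : (q a b : ℕ) → words q (a + b) ≡ cartesianProductWith _++_ (words q a) (words q b)
words-+ q zero    b = sym (trans (++-identityʳ (map ([] ++_) (words q b))) (map-id (words q b)))
words-+ q (suc a) b = begin
  words q (suc a + b)                                                         ≡⟨ words-suc q (a + b) ⟩
  cartesianProductWith _∷_ (allFin q) (words q (a + b))                       ≡⟨ cong (cartesianProductWith _∷_ (allFin q)) (words-+ q a b) ⟩
  cartesianProductWith _∷_ (allFin q) (cartesianProductWith _++_ (words q a) (words q b))
    ≡⟨ cartesianProductWith-assoc _∷_ _++_ _++_ _∷_ (λ _ _ _ → refl) (allFin q) (words q a) (words q b) ⟩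
  cartesianProductWith _++_ (cartesianProductWith _∷_ (allFin q) (words q a)) (words q b)
    ≡⟨ cong (λ ws → cartesianProductWith _++_ ws (words q b)) (words-suc q a) ⟨
  cartesianProductWith _++_ (words q (suc a)) (words q b)                     ∎
  where open ≡-Reasoning

words-unique : (q n : ℕ) → Unique (words q n)
words-unique q zero    = [] ∷ []
words-unique q (suc n) =
  subst Unique (sym (words-suc q n)) (cartesianProductWith⁺ _∷_ ∷-injective (allFin⁺ q) (words-unique q n))

words-length : (q n : ℕ) → All (λ w → length w ≡ n) (words q n)
words-length q zero    = refl ∷ []
words-length q (suc n) =
  subst (All _) (sym (words-suc q n)) (All-cartesianProductWith _∷_ (allFin q) (cong suc) (words-length q n))

length-words : (q n : ℕ) → length (words q n) ≡ q ^ n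
length-words q zero    = refl
length-words q (suc n) = begin
  length (words q (suc n))                                       ≡⟨ cong length (words-suc q n) ⟩
  length (cartesianProductWith _∷_ (allFin q) (words q n))       ≡⟨ length-cartesianProductWith _∷_ (allFin q) (words q n) ⟩
  length (allFin q) * length (words q n)                         ≡⟨ cong₂ _*_ (length-tabulate {n = q} (λ i → i)) (length-words q n) ⟩
  q * q ^ n                                                      ∎
  where open ≡-Reasoning

count-words-+ : (q a b : ℕ) (P : Word q → Bool) →
  count P (words q (a + b)) ≡ sum (map (λ x → count (λ y → P (x ++ y)) (words q b)) (words q a))
count-words-+ q a b P =
  trans (cong (count P) (words-+ q a b)) (count-cartesianProductWith P _++_ (words q a) (words q b))

count-words-≤1 : (n : ℕ) (P : Word q → Bool) →
  (∀ {y y′} → length y ≡ n → length y′ ≡ n → T (P y) → T (P y′) → y ≡ y′) → count P (words q n) ≤ 1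
count-words-≤1 {q} n P = count-unique-≤1 P (words-unique q n) (words-length q n)

count-words-+-≤ : (a b : ℕ) (P Q : Word q → Bool) →
  (∀ x {y} → length x ≡ a → length y ≡ b → T (P (x ++ y)) → T (Q x)) →
  (∀ x {y y′} → length x ≡ a → length y ≡ b → length y′ ≡ b → T (P (x ++ y)) → T (P (x ++ y′)) → y ≡ y′) →
  count P (words q (a + b)) ≤ count Q (words q a)
count-words-+-≤ {q} a b P Q prefix unique = begin
  count P (words q (a + b))                                            ≡⟨ count-words-+ q a b P ⟩
  sum (map (λ x → count (λ y → P (x ++ y)) (words q b)) (words q a))  ≤⟨ sum-map-mono (All.map fibre (words-length q a)) ⟩
  sum (map (λ x → count Q (x ∷ [])) (words q a))                       ≡⟨ count-as-sum Q (words q a) ⟨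
  count Q (words q a)                                                  ∎
  where
  open ≤-Reasoning
  fibre : ∀ {x} → length x ≡ a → count (λ y → P (x ++ y)) (words q b) ≤ count Q (x ∷ [])
  fibre {x} ∣x∣ with Q x in Qx
  ... | true  = count-words-≤1 b _ (unique x ∣x∣)
  ... | false = ≤-reflexive (count-none _ (All.map (λ ∣y∣ Pxy → subst T Qx (prefix x ∣x∣ ∣y∣ Pxy)) (words-length q b)))

++-cancel-≡-length : (xs ys us vs : List X) → xs ++ ys ≡ us ++ vs → length xs ≡ length us → xs ≡ us × ys ≡ vs
++-cancel-≡-length []       ys []       vs eq _   = refl , eq
++-cancel-≡-length (x ∷ xs) ys (u ∷ us) vs eq len with ∷-injective eq
... | refl , eq′ with ++-cancel-≡-length xs ys us vs eq′ (suc-injective len)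
... | refl , ys≡vs = refl , ys≡vs

++-cancel-≡-lengthʳ : (xs ys us vs : List X) → xs ++ ys ≡ us ++ vs → length ys ≡ length vs → xs ≡ us × ys ≡ vs
++-cancel-≡-lengthʳ xs ys us vs eq len = ++-cancel-≡-length xs ys us vs eq (+-cancelʳ-≡ (length vs) _ _ (begin
  length xs + length vs  ≡⟨ cong (length xs +_) len ⟨
  length xs + length ys  ≡⟨ length-++ xs ⟨
  length (xs ++ ys)      ≡⟨ cong length eq ⟩
  length (us ++ vs)      ≡⟨ length-++ us ⟩
  length us + length vs  ∎))
  where open ≡-Reasoning

++-≡-prefix : (xs ys us vs : List X) → xs ++ ys ≡ us ++ vs → length xs ≤ length us → ∃[ s ] us ≡ xs ++ s
++-≡-prefix []       ys us       vs eq _         = us , refl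
++-≡-prefix (x ∷ xs) ys (u ∷ us) vs eq (s≤s len) with ∷-injective eq
... | refl , eq′ with ++-≡-prefix xs ys us vs eq′ len
... | s , refl = s , refl

reverse-≡-++ : (vs as bs : List X) → reverse vs ≡ as ++ bs → vs ≡ reverse bs ++ reverse as
reverse-≡-++ vs as bs eq = begin
  vs                        ≡⟨ reverse-involutive vs ⟨
  reverse (reverse vs)      ≡⟨ cong reverse eq ⟩
  reverse (as ++ bs)        ≡⟨ reverse-++ as bs ⟩
  reverse bs ++ reverse as  ∎
  where open ≡-Reasoning

++-≡-suffix : (xs ys us vs : List X) → xs ++ ys ≡ us ++ vs → length ys ≤ length vs → ∃[ s ] vs ≡ s ++ ys
++-≡-suffix xs ys us vs eq len with ++-≡-prefix (reverse ys) (reverse xs) (reverse vs) (reverse us)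
  (trans (sym (reverse-++ xs ys)) (trans (cong reverse eq) (reverse-++ us vs)))
  (subst₂ _≤_ (sym (length-reverse ys)) (sym (length-reverse vs)) len)
... | s , eq′ = reverse s , trans (reverse-≡-++ vs (reverse ys) s eq′) (cong (reverse s ++_) (reverse-involutive ys))

0<length-++ˡ : (xs ys zs : List X) → xs ≡ ys ++ zs → length zs < length xs → 0 < length ys
0<length-++ˡ xs []      zs refl zs<zs = contradiction zs<zs (n≮n (length zs))
0<length-++ˡ xs (_ ∷ _) zs _    _     = s≤s z≤n

take-take-≤ : {k n : ℕ} (xs : List X) → k ≤ n → take k (take n xs) ≡ take k xs
take-take-≤ {k = k} {n} xs k≤n = trans (take-take k n xs) (cong (λ i → take i xs) (m≤n⇒m⊓n≡m k≤n))

take-++-take : (j i : ℕ) (xs ys : List X) → j ≤ length xs + i → take j (xs ++ ys) ≡ take j (xs ++ take i ys)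
take-++-take j       i []       ys j≤i       = sym (take-take-≤ ys j≤i)
take-++-take zero    i (x ∷ xs) ys _         = refl
take-++-take (suc j) i (x ∷ xs) ys (s≤s j≤) = cong (x ∷_) (take-++-take j i xs ys j≤)

take-fixpoint-unique : (n : ℕ) (xs ys ys′ : List X) → 0 < length xs →
  ys ≡ take n (xs ++ ys) → ys′ ≡ take n (xs ++ ys′) → ys ≡ ys′
take-fixpoint-unique n xs ys ys′ 0<∣xs∣ fix fix′ = begin
  ys             ≡⟨ take-fixpoint fix ⟨
  take n ys      ≡⟨ prefixes-agree n ≤-refl ⟩
  take n ys′     ≡⟨ take-fixpoint fix′ ⟩
  ys′            ∎
  where
  open ≡-Reasoning
  take-fixpoint : ∀ {zs} → zs ≡ take n (xs ++ zs) → take n zs ≡ zs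
  take-fixpoint {zs} fx = trans (cong (take n) fx) (trans (take-take-≤ (xs ++ zs) ≤-refl) (sym fx))
  unfold : ∀ {zs} k → zs ≡ take n (xs ++ zs) → suc k ≤ n → take (suc k) zs ≡ take (suc k) (xs ++ take k zs)
  unfold {zs} k fx k<n = begin
    take (suc k) zs                      ≡⟨ cong (take (suc k)) fx ⟩
    take (suc k) (take n (xs ++ zs))     ≡⟨ take-take-≤ (xs ++ zs) k<n ⟩
    take (suc k) (xs ++ zs)              ≡⟨ take-++-take (suc k) k xs zs (+-monoˡ-≤ k 0<∣xs∣) ⟩
    take (suc k) (xs ++ take k zs)       ∎
  prefixes-agree : ∀ k → k ≤ n → take k ys ≡ take k ys′
  prefixes-agree zero    _   = refl
  prefixes-agree (suc k) k<n = begin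
    take (suc k) ys                      ≡⟨ unfold k fix k<n ⟩
    take (suc k) (xs ++ take k ys)       ≡⟨ cong (λ zs → take (suc k) (xs ++ zs)) (prefixes-agree k (<⇒≤ k<n)) ⟩
    take (suc k) (xs ++ take k ys′)      ≡⟨ unfold k fix′ k<n ⟨
    take (suc k) ys′                     ∎

isPrefix⇒ : (w u : Word q) → T (isPrefix w u) → ∃[ s ] u ≡ w ++ s
isPrefix⇒ []      u       _  = u , refl
isPrefix⇒ (a ∷ w) (b ∷ u) pr with a ≟ b
... | yes refl with isPrefix⇒ w u pr
...   | s , refl = s , refl

isPrefix-++ : (w s : Word q) → T (isPrefix w (w ++ s))
isPrefix-++ []      s = _
isPrefix-++ (a ∷ w) s with a ≟ a
... | yes _  = isPrefix-++ w s
... | no a≢a = a≢a refl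

isPrefix-extend : (w u t : Word q) → T (isPrefix w u) → T (isPrefix w (u ++ t))
isPrefix-extend w u t pr with isPrefix⇒ w u pr
... | s , refl = subst (T ∘ isPrefix w) (sym (++-assoc w s t)) (isPrefix-++ w (s ++ t))

isSuffix⇒ : (w u : Word q) → T (isSuffix w u) → ∃[ t ] u ≡ t ++ w
isSuffix⇒ w u su with isPrefix⇒ (reverse w) (reverse u) su
... | s , eq = reverse s , trans (reverse-≡-++ u (reverse w) s eq) (cong (reverse s ++_) (reverse-involutive w))

occ-∷-prefix : (w : Word q) (a : Fin q) (u : Word q) → T (isPrefix w (a ∷ u)) → occ w (a ∷ u) ≡ suc (occ w u)
occ-∷-prefix w a u pr with isPrefix w (a ∷ u)
... | true = refl

occ-self : (w : Word q) → 1 ≤ occ w w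
occ-self []      = ≤-refl
occ-self (a ∷ w) = subst (1 ≤_) (sym (occ-∷-prefix (a ∷ w) a w self)) (s≤s z≤n)
  where
  self : T (isPrefix (a ∷ w) (a ∷ w))
  self = subst (T ∘ isPrefix (a ∷ w) ∘ (a ∷_)) (++-identityʳ w) (isPrefix-++ (a ∷ w) [])

occ-++ʳ : (w x y : Word q) → occ w y ≤ occ w (x ++ y)
occ-++ʳ w []      y = ≤-refl
occ-++ʳ w (a ∷ x) y = ≤-trans (occ-++ʳ w x y) (m≤n+m _ _)

occ-++ : (a : Fin q) (w x y : Word q) → occ (a ∷ w) x + occ (a ∷ w) y ≤ occ (a ∷ w) (x ++ y)
occ-++ a w []      y = ≤-refl
occ-++ a w (b ∷ x) y with isPrefix (a ∷ w) (b ∷ x) in pr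
... | true  = ≤-trans (s≤s (occ-++ a w x y))
                (≤-reflexive (sym (occ-∷-prefix (a ∷ w) b (x ++ y) (isPrefix-extend (a ∷ w) (b ∷ x) y (subst T (sym pr) _)))))
... | false = ≤-trans (occ-++ a w x y) (m≤n+m _ _)

-- The three occurrences start at positions 0, |t| and |t| + |s′|.
occ-border-of-suffix : (w a t v s s′ : Word q) → w ++ a ≡ t ++ v → v ≡ w ++ s → v ≡ s′ ++ w →
  0 < length t → 0 < length s′ → 3 ≤ occ w (t ++ v)
occ-border-of-suffix w a (c ∷ t) v s (d ∷ s′) u≡wa v≡ws v≡s′w _ _ = begin
  3                             ≤⟨ s≤s (s≤s (occ-self w)) ⟩
  suc (suc (occ w w))           ≤⟨ s≤s (s≤s (occ-++ʳ w s′ w)) ⟩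
  suc (suc (occ w (s′ ++ w)))   ≡⟨ cong suc (occ-∷-prefix w d (s′ ++ w) w-prefix-of-v) ⟨
  suc (occ w (d ∷ s′ ++ w))     ≡⟨ cong (suc ∘ occ w) v≡s′w ⟨
  suc (occ w v)                 ≤⟨ s≤s (occ-++ʳ w t v) ⟩
  suc (occ w (t ++ v))          ≡⟨ occ-∷-prefix w c (t ++ v) w-prefix-of-u ⟨
  occ w (c ∷ t ++ v)            ∎
  where
  open ≤-Reasoning
  w-prefix-of-u : T (isPrefix w (c ∷ t ++ v))
  w-prefix-of-u = subst (T ∘ isPrefix w) u≡wa (isPrefix-++ w a)
  w-prefix-of-v : T (isPrefix w (d ∷ s′ ++ w))
  w-prefix-of-v = subst (T ∘ isPrefix w) (trans (sym v≡ws) v≡s′w) (isPrefix-++ w s)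

occ-sandwich : (w v : Word q) → 0 < length w → T (isFactor w v) → 3 ≤ occ w (w ++ v ++ w)
occ-sandwich {q} (a ∷ w) v _ factor = begin
  3                                    ≤⟨ +-mono-≤ (occ-self (a ∷ w)) (+-mono-≤ (<ᵇ⇒< 0 (occ′ v) factor) (occ-self (a ∷ w))) ⟩
  occ′ (a ∷ w) + (occ′ v + occ′ (a ∷ w)) ≤⟨ +-monoʳ-≤ (occ′ (a ∷ w)) (occ-++ a w v (a ∷ w)) ⟩
  occ′ (a ∷ w) + occ′ (v ++ a ∷ w)     ≤⟨ occ-++ a w (a ∷ w) (v ++ a ∷ w) ⟩
  occ′ (a ∷ w ++ v ++ a ∷ w)           ∎
  where
  open ≤-Reasoning
  occ′ : Word q → ℕ
  occ′ = occ (a ∷ w)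

isBorder⇒ : (w u : Word q) → T (isBorder w u) → length w < length u × (∃[ s ] u ≡ w ++ s) × (∃[ t ] u ≡ t ++ w)
isBorder⇒ w u border =
  let _ , rest       = Equivalence.to (T-∧ {nonEmpty w}) border
      shorter , ends = Equivalence.to (T-∧ {length w <ᵇ length u}) rest
      pre , suf      = Equivalence.to (T-∧ {isPrefix w u}) ends
  in <ᵇ⇒< _ _ shorter , isPrefix⇒ w u pre , isSuffix⇒ w u suf

hasBorderOfLength⇒ : (m : ℕ) (u : Word q) → T (hasBorderOfLength m u) →
  length (take m u) ≡ m × m < length u × ∃[ t ] u ≡ t ++ take m u
hasBorderOfLength⇒ m u h =
  let border , len = Equivalence.to (T-∧ {isBorder (take m u) u}) h
      ∣w∣≡m = ≡ᵇ⇒≡ _ _ len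
      shorter , _ , suffix = isBorder⇒ (take m u) u border
  in ∣w∣≡m , subst (_< length u) ∣w∣≡m shorter , suffix

closedMaxBorder : (m : ℕ) → Word q → Bool
closedMaxBorder m u = closed u ∧ maxBorderLength m u

closedMaxBorder⇒hasBorderOfLength : (m : ℕ) (u : Word q) → T (closedMaxBorder m u) → T (hasBorderOfLength m u)
closedMaxBorder⇒hasBorderOfLength m u c =
  proj₁ (Equivalence.to T-∧ (proj₂ (Equivalence.to (T-∧ {closed u}) c)))

closedMaxBorder⇒closingBorder : (m : ℕ) (u : Word q) → T (closedMaxBorder m u) →
  ∃[ w ] T (isBorder w u) × occ w u ≡ 2 × length w ≤ m
closedMaxBorder⇒closingBorder {q} m u c =
  let isClosed , isMax = Equivalence.to (T-∧ {closed u}) c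
      _ , maximal      = Equivalence.to (T-∧ {hasBorderOfLength m u}) isMax
      witness          = any⁻ _ candidates isClosed
      short , good     = All.lookupAny (all⁺ _ candidates maximal) witness
      w                = Any.lookup witness
      border , twice   = Equivalence.to (T-∧ {isBorder w u}) good
  in w , border , ≡ᵇ⇒≡ _ _ twice , s≤s⁻¹ (<ᵇ⇒< _ _ (modus-ponens border short))
  where
  candidates : List (Word q)
  candidates = concatMap (words q) (upTo (length u))
  modus-ponens : ∀ {a b} → T a → T (not a ∨ b) → T b
  modus-ponens {true} _ t = t

closedMaxBorder⇒occ≡2 : (m : ℕ) (u : Word q) → T (closedMaxBorder m u) → occ (take m u) u ≡ 2
closedMaxBorder⇒occ≡2 {q} m u c
  with w , border , twice , ∣w∣≤m ← closedMaxBorder⇒closingBorder m u c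
  with _ , (s , u≡ws) , (t′ , u≡t′w) ← isBorder⇒ w u border
  with ∣wₘ∣≡m , m<∣u∣ , (t , u≡twₘ) ← hasBorderOfLength⇒ m u (closedMaxBorder⇒hasBorderOfLength m u c)
  with m≤n⇒m<n∨m≡n ∣w∣≤m
... | inj₂ ∣w∣≡m = subst (λ v → occ v u ≡ 2) w≡wₘ twice
  where
  w≡wₘ : w ≡ take m u
  w≡wₘ = proj₁ (++-cancel-≡-length w s (take m u) (drop m u)
           (trans (sym u≡ws) (sym (take++drop≡id m u))) (trans ∣w∣≡m (sym ∣wₘ∣≡m)))
... | inj₁ ∣w∣<m = contradiction (≤-reflexive twice) (<⇒≱ (subst (2 <_) (cong (occ w) (sym u≡twₘ)) three))
  where
  wₘ : Word q
  wₘ = take m u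
  ∣w∣≤∣wₘ∣ : length w ≤ length wₘ
  ∣w∣≤∣wₘ∣ = subst (length w ≤_) (sym ∣wₘ∣≡m) ∣w∣≤m
  wₘ-starts-with-w : ∃[ s₁ ] wₘ ≡ w ++ s₁
  wₘ-starts-with-w = ++-≡-prefix w s wₘ (drop m u) (trans (sym u≡ws) (sym (take++drop≡id m u))) ∣w∣≤∣wₘ∣
  wₘ-ends-with-w : ∃[ s₂ ] wₘ ≡ s₂ ++ w
  wₘ-ends-with-w = ++-≡-suffix t′ w t wₘ (trans (sym u≡t′w) u≡twₘ) ∣w∣≤∣wₘ∣
  three : 3 ≤ occ w (t ++ wₘ)
  three = occ-border-of-suffix w s t wₘ (proj₁ wₘ-starts-with-w) (proj₁ wₘ-ends-with-w)
    (trans (sym u≡ws) u≡twₘ) (proj₂ wₘ-starts-with-w) (proj₂ wₘ-ends-with-w)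
    (0<length-++ˡ u t wₘ u≡twₘ (subst (_< length u) (sym ∣wₘ∣≡m) m<∣u∣))
    (0<length-++ˡ wₘ (proj₁ wₘ-ends-with-w) w (proj₂ wₘ-ends-with-w) (subst (length w <_) (sym ∣wₘ∣≡m) ∣w∣<m))

hasBorderOfLength-++⇒≡take : (m : ℕ) (x y : Word q) → length y ≡ m → T (hasBorderOfLength m (x ++ y)) →
  0 < length x × y ≡ take m (x ++ y)
hasBorderOfLength-++⇒≡take m x y ∣y∣≡m h
  with ∣wₘ∣≡m , m<∣u∣ , (t , u≡twₘ) ← hasBorderOfLength⇒ m (x ++ y) h
  = 0<length-++ˡ (x ++ y) x y refl (subst (_< length (x ++ y)) (sym ∣y∣≡m) m<∣u∣)
  , proj₂ (++-cancel-≡-lengthʳ x y t (take m (x ++ y)) u≡twₘ (trans ∣y∣≡m (sym ∣wₘ∣≡m)))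

closedMaxBorder-sandwich : (m : ℕ) (x v z : Word q) → 0 < m → length x ≡ m → length z ≡ m →
  T (closedMaxBorder m (x ++ v ++ z)) → z ≡ x × T (not (isFactor x v))
closedMaxBorder-sandwich {q} m x v z 0<m ∣x∣≡m ∣z∣≡m c
  with ∣wₘ∣≡m , _ , (t , u≡twₘ) ← hasBorderOfLength⇒ m (x ++ v ++ z) (closedMaxBorder⇒hasBorderOfLength m _ c)
  = z≡x , not-factor
  where
  u : Word q
  u = x ++ v ++ z
  x≡wₘ : x ≡ take m u
  x≡wₘ = proj₁ (++-cancel-≡-length x (v ++ z) (take m u) (drop m u) (sym (take++drop≡id m u)) (trans ∣x∣≡m (sym ∣wₘ∣≡m)))
  z≡x : z ≡ x
  z≡x = trans (proj₂ (++-cancel-≡-lengthʳ (x ++ v) z t (take m u) (trans (++-assoc x v z) u≡twₘ) (trans ∣z∣≡m (sym ∣wₘ∣≡m))))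
              (sym x≡wₘ)
  occ≡2 : occ x (x ++ v ++ x) ≡ 2
  occ≡2 = subst₂ (λ w z → occ w (x ++ v ++ z) ≡ 2) (sym x≡wₘ) z≡x (closedMaxBorder⇒occ≡2 m u c)
  not-factor : T (not (isFactor x v))
  not-factor with isFactor x v in factor
  ... | false = _
  ... | true  = <⇒≱ (occ-sandwich x v (subst (0 <_) (sym ∣x∣≡m) 0<m) (subst T (sym factor) _)) (≤-reflexive occ≡2)

p+p≤n⇒p≤ceilHalf : (p n : ℕ) → p + p ≤ n → p ≤ ceilHalf n
p+p≤n⇒p≤ceilHalf p n 2p≤n = subst (_≤ ceilHalf n) (m*n/n≡m p 2) (/-monoˡ-≤ 2 (begin
  p * 2        ≡⟨ *-comm p 2 ⟩
  p + (p + 0)  ≡⟨ cong (p +_) (+-identityʳ p) ⟩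
  p + p        ≤⟨ 2p≤n ⟩
  n            ≤⟨ m≤m+n n 1 ⟩
  n + 1        ∎))
  where open ≤-Reasoning

n≤m⇒B≡0 : (q n m : ℕ) → n ≤ m → B q n m ≡ 0
n≤m⇒B≡0 q n m n≤m = count-none (closedMaxBorder m) (All.map (λ {u} → too-short u) (words-length q n))
  where
  too-short : ∀ u → length u ≡ n → ¬ T (closedMaxBorder m u)
  too-short u ∣u∣≡n c = <⇒≱ (subst (m <_) ∣u∣≡n m<∣u∣) n≤m
    where
    m<∣u∣ : m < length u
    m<∣u∣ = proj₁ (proj₂ (hasBorderOfLength⇒ m u (closedMaxBorder⇒hasBorderOfLength m u c)))

B≤q^ceilHalf : (q n m : ℕ) .{{_ : NonZero q}} → n < 2 * m → B q n m ≤ q ^ ceilHalf n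
B≤q^ceilHalf q n m n<2m with m <? n
... | no  m≮n = ≤-trans (≤-reflexive (n≤m⇒B≡0 q n m (≮⇒≥ m≮n))) z≤n
... | yes m<n = begin
  count (closedMaxBorder m) (words q n)        ≡⟨ cong (count (closedMaxBorder m) ∘ words q) p+m≡n ⟨
  count (closedMaxBorder m) (words q (p + m))  ≤⟨ count-words-+-≤ p m _ (λ _ → true) _ suffix-determined ⟩
  count (λ _ → true) (words q p)               ≡⟨ count-true (words q p) ⟩
  length (words q p)                           ≡⟨ length-words q p ⟩
  q ^ p                                        ≤⟨ ^-monoʳ-≤ q (p+p≤n⇒p≤ceilHalf p n p+p≤n) ⟩
  q ^ ceilHalf n                               ∎
  where
  open ≤-Reasoning
  p : ℕ
  p = n ∸ m
  p+m≡n : p + m ≡ n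
  p+m≡n = m∸n+n≡m (<⇒≤ m<n)
  p+p≤n : p + p ≤ n
  p+p≤n = subst (p + p ≤_) p+m≡n (+-monoʳ-≤ p (<⇒≤ (+-cancelʳ-< m p m (begin-strict
    p + m        ≡⟨ p+m≡n ⟩
    n            <⟨ n<2m ⟩
    m + (m + 0)  ≡⟨ cong (m +_) (+-identityʳ m) ⟩
    m + m        ∎))))
  suffix-determined : ∀ x {y y′} → length x ≡ p → length y ≡ m → length y′ ≡ m →
    T (closedMaxBorder m (x ++ y)) → T (closedMaxBorder m (x ++ y′)) → y ≡ y′
  suffix-determined x {y} {y′} _ ∣y∣≡m ∣y′∣≡m c c′ =
    let 0<∣x∣ , y≡ = hasBorderOfLength-++⇒≡take m x y ∣y∣≡m (closedMaxBorder⇒hasBorderOfLength m _ c)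
        _ , y′≡    = hasBorderOfLength-++⇒≡take m x y′ ∣y′∣≡m (closedMaxBorder⇒hasBorderOfLength m _ c′)
    in take-fixpoint-unique m x y y′ 0<∣x∣ y≡ y′≡

B≤q^m*μ : (q n m : ℕ) → 0 < m → 2 * m ≤ n → B q n m ≤ q ^ m * μ q (n ∸ 2 * m) m
B≤q^m*μ q n m 0<m 2m≤n = begin
  count (closedMaxBorder m) (words q n)
    ≡⟨ cong (count (closedMaxBorder m) ∘ words q) m+[k+m]≡n ⟨
  count (closedMaxBorder m) (words q (m + (k + m)))
    ≡⟨ count-words-+ q m (k + m) (closedMaxBorder m) ⟩
  sum (map (λ x → count (λ r → closedMaxBorder m (x ++ r)) (words q (k + m))) (words q m))
    ≤⟨ sum-map-≤-* (All.zipWith (λ (≤avoid , avoid≤) → ≤-trans ≤avoid avoid≤)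
                     (All.map fibre (words-length q m) , ≤-foldr-⊔ (λ w → avoid w k) (words q m))) ⟩
  length (words q m) * μ q k m
    ≡⟨ cong (_* μ q k m) (length-words q m) ⟩
  q ^ m * μ q k m
    ∎
  where
  open ≤-Reasoning
  k : ℕ
  k = n ∸ 2 * m
  m+[k+m]≡n : m + (k + m) ≡ n
  m+[k+m]≡n = begin-equality
    m + (k + m)  ≡⟨ +-comm m (k + m) ⟩
    k + m + m    ≡⟨ +-assoc k m m ⟩
    k + (m + m)  ≡⟨ cong (λ i → k + (m + i)) (+-identityʳ m) ⟨
    k + 2 * m    ≡⟨ m∸n+n≡m 2m≤n ⟩
    n            ∎
  fibre : ∀ {x} → length x ≡ m → count (λ r → closedMaxBorder m (x ++ r)) (words q (k + m)) ≤ avoid x k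
  fibre {x} ∣x∣≡m = count-words-+-≤ k m _ (λ v → not (isFactor x v))
    (λ v {z} _ ∣z∣≡m c → proj₂ (closedMaxBorder-sandwich {q} m x v z 0<m ∣x∣≡m ∣z∣≡m c))
    (λ v {z} {z′} _ ∣z∣≡m ∣z′∣≡m c c′ →
      trans (proj₁ (closedMaxBorder-sandwich {q} m x v z 0<m ∣x∣≡m ∣z∣≡m c))
            (sym (proj₁ (closedMaxBorder-sandwich m x v z′ 0<m ∣x∣≡m ∣z′∣≡m c′))))

lemma2 : (q : ℕ) → 1 < q → (n m : ℕ) → 1 ≤ n → 1 ≤ m → (n < 2 * m → B q n m ≤ q ^ ceilHalf n) × (2 * m ≤ n → B q n m ≤ q ^ m * μ q (n ∸ 2 * m) m)
lemma2 q 1<q n m _ 0<m = B≤q^ceilHalf q n m {{>-nonZero (<-trans z<s 1<q)}} , B≤q^m*μ q n m 0<m
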